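{- Let $P$ be a poset that is UCTP with top chain. Then every induced $P$-saturating family $\mathcal F\subseteq 2^{[n]}$ is separating; consequently $\mathrm{sat}^*(n,P)\ge\log_2 n$ for all $n\ge1$.
   Context: In a poset, $y$ covers $x$ if $x<y$ and there is no $z$ with $x<z<y$. A poset has the unique cover twin property (UCTP) if whenever $y$ covers $x$, there is an element $z$ that is comparable to one of $x,y$ and incomparable to the other. A poset $P$ is UCTP with top chain if $P$ is the union of a poset $P_0$ with $|P_0|\ge 2$ that has UCTP and a chain $C$ such that every element of $P_0$ is smaller than every element of $C$. A subfamily $\mathcal G\subseteq\mathcal F\subseteq 2^{[n]}$ is an induced copy of $P$ if there is a bijection $i:P\to\mathcal G$ with $p\le_P q$ iff $i(p)\subseteq i(q)$; $\mathcal F$ is induced $P$-saturating if it has no induced copy of $P$ and adding any $G\in2^{[n]}\setminus\mathcal F$ creates one. $\mathcal F$ is separating if for any two distinct $x,y\in[n]$ some $F\in\mathcal F$ has $|F\cap\{x,y\}|=1$. $\mathrm{sat}^*(n,P)$ is the minimum size of an induced $P$-saturating family in $2^{[n]}$. -}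

module Defs where

open import Data.Nat using (ℕ)
open import Data.Bool using (Bool; true)
open import Data.Fin using (Fin)
open import Data.Fin.Subset using (Subset; _∈_; _∉_; _⊆_)
open import Data.Product using (Σ; ∃; ∃-syntax; _×_; _,_)
open import Data.Sum using (_⊎_)
open import Data.List using (List; _∷_)
open import Data.List.Membership.Propositional using () renaming (_∈_ to _∈ˡ_; _∉_ to _∉ˡ_)
open import Relation.Nullary using (¬_)
open import Relation.Binary.PropositionalEquality using (_≡_; _≢_)
open import Function.Base using (_∘_)

-- A finite poset on the carrier Fin k is given by a relation _≼_ which is
-- a partial order w.r.t. _≡_ (Relation.Binary.Structures.IsPartialOrder).

module _ {k : ℕ} (_≼_ : Fin k → Fin k → Set) where

  _≺_ : Fin k → Fin k → Set
  x ≺ y = (x ≼ y) × (x ≢ y)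

  Comparable : Fin k → Fin k → Set
  Comparable x y = (x ≼ y) ⊎ (y ≼ x)

  CoversIn : (S : Fin k → Bool) → Fin k → Fin k → Set
  CoversIn S x y = (x ≺ y) × ((z : Fin k) → S z ≡ true → ¬ ((x ≺ z) × (z ≺ y)))

  UCTPOn : (S : Fin k → Bool) → Set
  UCTPOn S = (x y : Fin k) → S x ≡ true → S y ≡ true → CoversIn S x y →
    ∃[ z ] (S z ≡ true ×
      ((Comparable z x × ¬ Comparable z y) ⊎ (Comparable z y × ¬ Comparable z x)))

  -- P is UCTP with top chain: P = P₀ ∪ C, where P₀ = {p | inP₀ p ≡ true}
  -- has at least 2 elements and UCTP, C = complement of P₀ is a chain,
  -- and every element of P₀ is strictly below every element of C.
  UCTPWithTopChain : Set
  UCTPWithTopChain = Σ (Fin k → Bool) λ inP₀ →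
      (∃[ a ] ∃[ b ] (a ≢ b × inP₀ a ≡ true × inP₀ b ≡ true))
    × UCTPOn inP₀
    × ((c d : Fin k) → ¬ (inP₀ c ≡ true) → ¬ (inP₀ d ≡ true) → Comparable c d)
    × ((p c : Fin k) → inP₀ p ≡ true → ¬ (inP₀ c ≡ true) → p ≺ c)

module _ {k : ℕ} (_≼_ : Fin k → Fin k → Set) {n : ℕ} where

  InducedCopy : List (Subset n) → Set
  InducedCopy 𝓕 = Σ (Fin k → Subset n) λ i →
      ((p : Fin k) → i p ∈ˡ 𝓕)
    × ((p q : Fin k) → i p ≡ i q → p ≡ q)
    × ((p q : Fin k) → (p ≼ q → i p ⊆ i q) × (i p ⊆ i q → p ≼ q))

  InducedSaturating : List (Subset n) → Set
  InducedSaturating 𝓕 = ¬ InducedCopy 𝓕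
    × ((G : Subset n) → G ∉ˡ 𝓕 → InducedCopy (G ∷ 𝓕))

Separating : {n : ℕ} → List (Subset n) → Set
Separating {n} 𝓕 = (x y : Fin n) → x ≢ y →
  ∃[ F ] (F ∈ˡ 𝓕 × ((x ∈ F × y ∉ F) ⊎ (x ∉ F × y ∈ F)))

module Submission where

-- Suppose x ≢ y lie in the same members of 𝓕. A set G with x ∈ G, y ∉ G is not in 𝓕, so saturation
-- gives a copy of P in 𝓕 ∪ {G} through G at some p. If K ∈ 𝓕 relates to all other members of 𝓕 as G
-- does (K - y for K minimal containing x; H ∪ ⁅ x ⁆ for H maximal if no member contains x), replacing
-- G by K yields a copy inside 𝓕, unless K is already used at some q: then p and q are comparable twins,
-- hence a cover pair that UCTP forbids. The top chain C is handled by the copy E through ⁅ x ⁆, which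
-- maps C into 𝓕; gluing E on C with (a modification of) the copy through K - y on P₀, for K minimal
-- below the least image of C, again gives a copy inside 𝓕. So 𝓕 separates points, and the vector
-- of memberships in 𝓕 is an injection of [n] into a set of size 2 ^ length 𝓕.

open import Defs
open import Data.Nat using (ℕ; _≤_)
open import Data.Nat.Logarithm using (⌈log₂_⌉)
open import Data.Fin using (Fin)
open import Data.Fin.Subset using (Subset)
open import Data.List using (List; length)
open import Data.List.Relation.Unary.Unique.Propositional using (Unique)
open import Data.Product using (_×_)
open import Relation.Binary.PropositionalEquality using (_≡_)
open import Relation.Binary.Structures using (IsPartialOrder)

open import Data.Bool using (Bool; true; false; if_then_else_) renaming (_≟_ to _≟ᵇ_)
open import Data.Bool.Properties using (not-¬)
open import Data.Empty using (⊥; ⊥-elim)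
open import Data.Fin using (zero; suc; combine; _≟_)
open import Data.Fin.Properties using (combine-injective; injective⇒≤; any?)
open import Data.Fin.Subset
  using (_∈_; _∉_; _⊆_; _⊈_; _⊂_; _─_; _-_; _∪_; ⁅_⁆; ∁; ∣_∣) renaming (⊥ to ∅)
open import Data.Fin.Subset.Properties
  using ( _∈?_; _⊆?_; ⊆-refl; ⊆-reflexive; ⊆-trans; ⊆-antisym; Empty-unique
        ; p⊂q⇒∣p∣<∣q∣; p⊆q⇒∁p⊇∁q; ∁p⊆∁q⇒p⊇q; p─q⊆p; x∈p∧x≢y⇒x∈p-y
        ; x∈⁅x⁆; x∈⁅y⁆⇒x≡y; x∈p∪q⁺; x∈p∪q⁻ )
open import Data.List using ([]; _∷_; filter)
open import Data.List.Extrema.Nat using (argmin; argmin-sel; f[argmin]≤f[xs])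
open import Data.List.Membership.Propositional
  using (find; lose) renaming (_∈_ to _∈ˡ_; _∉_ to _∉ˡ_)
open import Data.List.Membership.Propositional.Properties using (∈-filter⁺; ∈-filter⁻; ∈-allFin)
import Data.List.Relation.Unary.All as All
open import Data.List.Relation.Unary.Any using (here; there)
import Data.List.Relation.Unary.Any as Any
open import Data.Nat using (_^_)
open import Data.Nat.Logarithm using (⌈log₂⌉-mono-≤; ⌈log₂2^n⌉≡n)
open import Data.Nat.Properties using (<⇒≱; module ≤-Reasoning)
open import Data.Product using (_,_; proj₁; proj₂; ∃-syntax)
import Data.Product as Product
open import Data.Sum using (_⊎_; inj₁; inj₂; [_,_])
import Data.Sum as Sum
open import Data.Unit using (tt)
open import Data.Vec using (_∷_)
import Data.Vec as Vec
open import Data.Vec.Functional using (updateAt)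
open import Data.Vec.Functional.Properties using (updateAt-updates; updateAt-minimal)
open import Data.Vec.Properties using (≡-dec)
open import Function.Base using (const; _∘_)
open import Function.Bundles using (_⇔_; mk⇔; Equivalence)
open import Function.Definitions using (Injective)
open import Function.Properties.Equivalence using () renaming (sym to ⇔-sym; trans to ⇔-trans)
open import Relation.Binary.Definitions using (DecidableEquality)
open import Relation.Binary.PropositionalEquality using (_≢_; refl; sym; trans; subst)
open import Relation.Nullary using (¬_; Dec; yes; no; does; contradiction)
open import Relation.Nullary.Decidable
  using (dec-true; dec-false; decidable-stable; _×-dec_; _⊎-dec_; ¬?)
open import Relation.Unary using (Decidable)

open Equivalence using (to; from)

bit : Bool → Fin 2
bit false = zero
bit true  = suc zero

bit-injective : ∀ {b c} → bit b ≡ bit c → b ≡ c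
bit-injective {false} {false} _ = refl
bit-injective {true}  {true}  _ = refl

does-distinguishes : ∀ {A B : Set} (a? : Dec A) (b? : Dec B) → A → ¬ B → does a? ≢ does b?
does-distinguishes a? b? a ¬b rewrite dec-true a? a | dec-false b? ¬b = λ ()

module _ {n : ℕ} where

  membership-code : (𝓕 : List (Subset n)) → Fin n → Fin (2 ^ length 𝓕)
  membership-code []      x = zero
  membership-code (F ∷ 𝓕) x = combine (bit (does (x ∈? F))) (membership-code 𝓕 x)

  same-code⇒same-membership : ∀ 𝓕 {x y} → membership-code 𝓕 x ≡ membership-code 𝓕 y →
    ∀ {F} → F ∈ˡ 𝓕 → does (x ∈? F) ≡ does (y ∈? F)
  same-code⇒same-membership (G ∷ 𝓕) {x} {y} eq = λ where
      (here refl) → bit-injective (proj₁ heads-and-tails)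
      (there F∈𝓕) → same-code⇒same-membership 𝓕 (proj₂ heads-and-tails) F∈𝓕
    where
    heads-and-tails : bit (does (x ∈? G)) ≡ bit (does (y ∈? G)) × membership-code 𝓕 x ≡ membership-code 𝓕 y
    heads-and-tails = combine-injective (bit (does (x ∈? G))) (membership-code 𝓕 x)
                                        (bit (does (y ∈? G))) (membership-code 𝓕 y) eq

  separating⇒membership-code-injective : ∀ {𝓕} → Separating 𝓕 →
    Injective _≡_ _≡_ (membership-code 𝓕)
  separating⇒membership-code-injective {𝓕} sep {x} {y} eq with x ≟ y
  ... | yes x≡y = x≡y
  ... | no x≢y with sep x y x≢y
  ... | F , F∈𝓕 , inj₁ (x∈F , y∉F) =
    contradiction (same-code⇒same-membership 𝓕 eq F∈𝓕)
                  (does-distinguishes (x ∈? F) (y ∈? F) x∈F y∉F)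
  ... | F , F∈𝓕 , inj₂ (x∉F , y∈F) =
    contradiction (sym (same-code⇒same-membership 𝓕 eq F∈𝓕))
                  (does-distinguishes (y ∈? F) (x ∈? F) y∈F x∉F)

  separating⇒⌈log₂⌉≤length : ∀ {𝓕} → Separating 𝓕 → ⌈log₂ n ⌉ ≤ length 𝓕
  separating⇒⌈log₂⌉≤length {𝓕} sep = begin
    ⌈log₂ n ⌉                ≤⟨ ⌈log₂⌉-mono-≤ (injective⇒≤ (separating⇒membership-code-injective sep)) ⟩
    ⌈log₂ 2 ^ length 𝓕 ⌉    ≡⟨ ⌈log₂2^n⌉≡n (length 𝓕) ⟩
    length 𝓕                ∎
    where open ≤-Reasoning

module _ {A : Set} where

  ∃-argmin : (f : A → ℕ) {Q : A → Set} → Decidable Q → ∀ {L a} → a ∈ˡ L → Q a →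
    ∃[ m ] (m ∈ˡ L × Q m × (∀ {z} → z ∈ˡ L → Q z → f m ≤ f z))
  ∃-argmin f {Q} Q? {L} {a} a∈L Qa = m , proj₁ m∈L×Qm , proj₂ m∈L×Qm , least
    where
    candidates : List A
    candidates = filter Q? L
    m : A
    m = argmin f a candidates
    m∈L×Qm : m ∈ˡ L × Q m
    m∈L×Qm with argmin-sel f a candidates
    ... | inj₁ m≡a rewrite m≡a = a∈L , Qa
    ... | inj₂ m∈candidates = ∈-filter⁻ Q? m∈candidates
    least : ∀ {z} → z ∈ˡ L → Q z → f m ≤ f z
    least z∈L Qz = All.lookup (f[argmin]≤f[xs] a candidates) (∈-filter⁺ Q? z∈L Qz)

x∈p─q⇒x∉q : ∀ {n} {x : Fin n} (p q : Subset n) → x ∈ p ─ q → x ∉ q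
x∈p─q⇒x∉q (_ ∷ p) (_ ∷ q) (Vec.there x∈p─q) (Vec.there x∈q) = x∈p─q⇒x∉q p q x∈p─q x∈q

module _ {n : ℕ} where

  _≟ˢ_ : DecidableEquality (Subset n)
  _≟ˢ_ = ≡-dec _≟ᵇ_

  p⊆q∧p≢q⇒p⊂q : ∀ {p q : Subset n} → p ⊆ q → p ≢ q → p ⊂ q
  p⊆q∧p≢q⇒p⊂q {p} {q} p⊆q p≢q with any? (λ z → z ∈? q ×-dec ¬? (z ∈? p))
  ... | yes (z , z∈q , z∉p) = p⊆q , z , z∈q , z∉p
  ... | no none = contradiction (⊆-antisym p⊆q q⊆p) p≢q
    where
    q⊆p : q ⊆ p
    q⊆p {z} z∈q = decidable-stable (z ∈? p) (λ z∉p → none (z , z∈q , z∉p))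

  p⊆q∧∣q∣≤∣p∣⇒p≡q : ∀ {p q : Subset n} → p ⊆ q → ∣ q ∣ ≤ ∣ p ∣ → p ≡ q
  p⊆q∧∣q∣≤∣p∣⇒p≡q {p} {q} p⊆q ∣q∣≤∣p∣ =
    decidable-stable (p ≟ˢ q) (λ p≢q → <⇒≱ (p⊂q⇒∣p∣<∣q∣ (p⊆q∧p≢q⇒p⊂q p⊆q p≢q)) ∣q∣≤∣p∣)

  ∃-⊆-minimal : {Q : Subset n → Set} → Decidable Q → ∀ {𝓕 Z} → Z ∈ˡ 𝓕 → Q Z →
    ∃[ K ] (K ∈ˡ 𝓕 × Q K × (∀ {Z} → Z ∈ˡ 𝓕 → Q Z → Z ⊆ K → Z ≡ K))
  ∃-⊆-minimal Q? Z∈𝓕 QZ with ∃-argmin ∣_∣ Q? Z∈𝓕 QZ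
  ... | K , K∈𝓕 , QK , least = K , K∈𝓕 , QK , λ Z∈𝓕 QZ Z⊆K → p⊆q∧∣q∣≤∣p∣⇒p≡q Z⊆K (least Z∈𝓕 QZ)

  ∃-⊆-maximal : ∀ {𝓕 Z} → Z ∈ˡ 𝓕 → ∃[ H ] (H ∈ˡ 𝓕 × (∀ {Z} → Z ∈ˡ 𝓕 → H ⊆ Z → H ≡ Z))
  ∃-⊆-maximal Z∈𝓕 with ∃-argmin (λ Z → ∣ ∁ Z ∣) (λ _ → yes tt) Z∈𝓕 tt
  ... | H , H∈𝓕 , _ , least = H , H∈𝓕 , λ Z∈𝓕 H⊆Z →
    let ∁Z≡∁H = p⊆q∧∣q∣≤∣p∣⇒p≡q (p⊆q⇒∁p⊇∁q H⊆Z) (least Z∈𝓕 tt)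
    in ⊆-antisym H⊆Z (∁p⊆∁q⇒p⊇q (⊆-reflexive (sym ∁Z≡∁H)))

module PartialOrder {k : ℕ} {_≼_ : Fin k → Fin k → Set} (po : IsPartialOrder _≡_ _≼_) where

  open IsPartialOrder po using (antisym) renaming (refl to ≼-refl)

  Twins : Fin k → Fin k → Set
  Twins a b = ∀ r → r ≢ a → r ≢ b → (r ≼ a ⇔ r ≼ b) × (a ≼ r ⇔ b ≼ r)

  twins-sym : ∀ {a b} → Twins a b → Twins b a
  twins-sym tw r r≢b r≢a = Product.map ⇔-sym ⇔-sym (tw r r≢a r≢b)

  twins-cover : ∀ {S a b} → _≺_ _≼_ a b → Twins a b → CoversIn _≼_ S a b
  twins-cover a≺b tw = a≺b , λ where
    z _ ((a≼z , a≢z) , (z≼b , z≢b)) →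
      a≢z (antisym a≼z (from (proj₁ (tw z (a≢z ∘ sym) z≢b)) z≼b))

  twins-comparable : ∀ {a b} → a ≼ b → Twins a b → ∀ z → Comparable _≼_ z a ⇔ Comparable _≼_ z b
  twins-comparable {a} {b} a≼b tw z with z ≟ a | z ≟ b
  ... | yes refl | _        = mk⇔ (λ _ → inj₁ a≼b) (λ _ → inj₁ ≼-refl)
  ... | no _     | yes refl = mk⇔ (λ _ → inj₁ ≼-refl) (λ _ → inj₂ a≼b)
  ... | no z≢a   | no z≢b   =
    let below , above = tw z z≢a z≢b in
    mk⇔ (Sum.map (to below) (to above))
        (Sum.map (from below) (from above))

  module _ {S : Fin k → Bool} (uctp : UCTPOn _≼_ S) where

    UCTP⇒cover-distinguished : ∀ {a b} → S a ≡ true → S b ≡ true → CoversIn _≼_ S a b →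
      ¬ (∀ z → S z ≡ true → Comparable _≼_ z a ⇔ Comparable _≼_ z b)
    UCTP⇒cover-distinguished Sa Sb a⋖b same with uctp _ _ Sa Sb a⋖b
    ... | z , Sz , inj₁ (z~a , z≁b) = z≁b (to (same z Sz) z~a)
    ... | z , Sz , inj₂ (z~b , z≁a) = z≁a (from (same z Sz) z~b)

    UCTP⇒¬comparable-twins : ∀ {a b} → S a ≡ true → S b ≡ true → _≺_ _≼_ a b → ¬ Twins a b
    UCTP⇒¬comparable-twins Sa Sb a≺b tw =
      UCTP⇒cover-distinguished Sa Sb (twins-cover a≺b tw) (λ z _ → twins-comparable (proj₁ a≺b) tw z)

    UCTP⇒¬two-element-chain : ∀ {a b} → S a ≡ true → S b ≡ true → _≺_ _≼_ a b →
      ¬ (∀ z → S z ≡ true → z ≡ a ⊎ z ≡ b)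
    UCTP⇒¬two-element-chain {a} {b} Sa Sb a≺b@(a≼b , a≢b) only-a-b =
      UCTP⇒cover-distinguished Sa Sb a⋖b λ z Sz →
        mk⇔ (λ _ → comparable-to-b z Sz) (λ _ → comparable-to-a z Sz)
      where
      a⋖b : CoversIn _≼_ S a b
      a⋖b = a≺b , λ where
        z Sz ((_ , a≢z) , (_ , z≢b)) → [ a≢z ∘ sym , z≢b ] (only-a-b z Sz)
      comparable-to-a : ∀ z → S z ≡ true → Comparable _≼_ z a
      comparable-to-a z Sz = [ (λ { refl → inj₁ ≼-refl }) , (λ { refl → inj₂ a≼b }) ] (only-a-b z Sz)
      comparable-to-b : ∀ z → S z ≡ true → Comparable _≼_ z b
      comparable-to-b z Sz = [ (λ { refl → inj₁ a≼b }) , (λ { refl → inj₁ ≼-refl }) ] (only-a-b z Sz)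

  module _ {n : ℕ} where

    Faithful : (Fin k → Subset n) → Fin k → Fin k → Set
    Faithful i a b = a ≼ b ⇔ i a ⊆ i b

    OrderEmbedding : (Fin k → Subset n) → Set
    OrderEmbedding i = ∀ a b → Faithful i a b

    order-embedding-injective : ∀ {i} → OrderEmbedding i → Injective _≡_ _≡_ i
    order-embedding-injective emb {a} {b} i-a≡i-b =
      antisym (from (emb a b) (⊆-reflexive i-a≡i-b))
              (from (emb b a) (⊆-reflexive (sym i-a≡i-b)))

    induced-copy-embedding : ∀ {𝓖} (copy : InducedCopy _≼_ 𝓖) → OrderEmbedding (proj₁ copy)
    induced-copy-embedding (_ , _ , _ , faithful) a b =
      mk⇔ (proj₁ (faithful a b)) (proj₂ (faithful a b))

    SameRelations : Subset n → Subset n → Subset n → Set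
    SameRelations G K Z = (Z ⊆ G ⇔ Z ⊆ K) × (G ⊆ Z ⇔ K ⊆ Z)

    same-relations⇒twins : ∀ {i p q} → OrderEmbedding i →
      (∀ r → r ≢ p → r ≢ q → SameRelations (i p) (i q) (i r)) → Twins p q
    same-relations⇒twins {p = p} {q} emb same r r≢p r≢q =
      let below , above = same r r≢p r≢q in
      ⇔-trans (emb r p) (⇔-trans below (⇔-sym (emb r q))) ,
      ⇔-trans (emb p r) (⇔-trans above (⇔-sym (emb q r)))

    module Replacement {i : Fin k → Subset n} (emb : OrderEmbedding i) (p : Fin k) (K : Subset n) where

      i[p↦K] : Fin k → Subset n
      i[p↦K] = updateAt i p (const K)

      replaced-elim : ∀ (Q : Subset n → Set) {r} → Q K → (r ≢ p → Q (i r)) → Q (i[p↦K] r)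
      replaced-elim Q {r} QK Qi with r ≟ p
      ... | yes refl = subst Q (sym (updateAt-updates p i)) QK
      ... | no r≢p   = subst Q (sym (updateAt-minimal r p i r≢p)) (Qi r≢p)

      replaced-faithful : ∀ a b →
        (a ≢ p → SameRelations (i p) K (i a)) → (b ≢ p → SameRelations (i p) K (i b)) →
        Faithful i[p↦K] a b
      replaced-faithful a b same-a same-b with a ≟ p | b ≟ p
      ... | yes refl | yes refl = mk⇔ (λ _ {_} z∈ → z∈) (λ _ → ≼-refl)
      ... | yes refl | no b≢p
        rewrite updateAt-updates p {const K} i | updateAt-minimal b p {const K} i b≢p =
        ⇔-trans (emb p b) (proj₂ (same-b b≢p))
      ... | no a≢p | yes refl
        rewrite updateAt-minimal a p {const K} i a≢p | updateAt-updates p {const K} i =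
        ⇔-trans (emb a p) (proj₁ (same-a a≢p))
      ... | no a≢p | no b≢p
        rewrite updateAt-minimal a p {const K} i a≢p | updateAt-minimal b p {const K} i b≢p =
        emb a b

    module _ (inP₀ : Fin k → Bool) where

      glue : (Fin k → Subset n) → (Fin k → Subset n) → Fin k → Subset n
      glue f g r = if inP₀ r then f r else g r

      glue-elim : ∀ (Q : Subset n → Set) {f g r} →
        (inP₀ r ≡ true → Q (f r)) → (¬ inP₀ r ≡ true → Q (g r)) → Q (glue f g r)
      glue-elim Q {r = r} Qf Qg with inP₀ r
      ... | true  = Qf refl
      ... | false = Qg (λ ())

      glue-embedding : ∀ {f g} →
        (∀ a c → inP₀ a ≡ true → ¬ inP₀ c ≡ true → _≺_ _≼_ a c) →
        (∀ a b → inP₀ a ≡ true → inP₀ b ≡ true → Faithful f a b) →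
        (∀ c d → ¬ inP₀ c ≡ true → ¬ inP₀ d ≡ true → Faithful g c d) →
        (∀ a c → inP₀ a ≡ true → ¬ inP₀ c ≡ true → f a ⊆ g c) →
        (∀ a c → inP₀ a ≡ true → ¬ inP₀ c ≡ true → g c ⊈ f a) →
        OrderEmbedding (glue f g)
      glue-embedding P₀≺C f-faithful g-faithful f⊆g g⊈f a b with inP₀ a in P₀a | inP₀ b in P₀b
      ... | true  | true  = f-faithful a b P₀a P₀b
      ... | false | false = g-faithful a b (not-¬ P₀a) (not-¬ P₀b)
      ... | true  | false =
        mk⇔ (λ _ {z} → f⊆g a b P₀a (not-¬ P₀b) {z}) (λ _ → proj₁ (P₀≺C a b P₀a (not-¬ P₀b)))
      ... | false | true  =
        let b≼a , b≢a = P₀≺C b a P₀b (not-¬ P₀a) in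
        mk⇔ (λ a≼b → contradiction (antisym b≼a a≼b) b≢a)
            (λ ga⊆fb → ⊥-elim (g⊈f b a P₀b (not-¬ P₀a) (λ {z} → ga⊆fb {z})))

module Unseparated
  {k : ℕ} {_≼_ : Fin k → Fin k → Set} (po : IsPartialOrder _≡_ _≼_) {inP₀ : Fin k → Bool}
  (two : ∃[ a ] ∃[ b ] (a ≢ b × inP₀ a ≡ true × inP₀ b ≡ true))
  (uctp : UCTPOn _≼_ inP₀)
  (chain : (c d : Fin k) → ¬ (inP₀ c ≡ true) → ¬ (inP₀ d ≡ true) → Comparable _≼_ c d)
  (P₀≺C : (a c : Fin k) → inP₀ a ≡ true → ¬ (inP₀ c ≡ true) → _≺_ _≼_ a c)
  {n : ℕ} {𝓕 : List (Subset n)} (saturating : InducedSaturating _≼_ 𝓕)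
  {x y : Fin n} (x≢y : x ≢ y) (x⇔y : ∀ {Z} → Z ∈ˡ 𝓕 → x ∈ Z ⇔ y ∈ Z)
  where

  open PartialOrder po
  open IsPartialOrder po using (antisym; reflexive) renaming (refl to ≼-refl)

  P₀ : Fin k → Set
  P₀ r = inP₀ r ≡ true

  P₀? : ∀ r → Dec (P₀ r)
  P₀? r = inP₀ r ≟ᵇ true

  P₀-has-another : ∀ s → ∃[ r ] (P₀ r × r ≢ s)
  P₀-has-another s = another two
    where
    another : ∃[ a ] ∃[ b ] (a ≢ b × P₀ a × P₀ b) → ∃[ r ] (P₀ r × r ≢ s)
    another (a , b , a≢b , P₀a , P₀b) with a ≟ s
    ... | yes refl = b , P₀b , a≢b ∘ sym
    ... | no a≢s   = a , P₀a , a≢s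

  no-copy : ∀ {i} → (∀ r → i r ∈ˡ 𝓕) → OrderEmbedding i → ⊥
  no-copy {i} i∈𝓕 emb =
    proj₁ saturating
      (i , i∈𝓕 , (λ _ _ → order-embedding-injective emb) , λ a b → to (emb a b) , from (emb a b))

  separating∉𝓕 : ∀ {G} → x ∈ G → y ∉ G → G ∉ˡ 𝓕
  separating∉𝓕 x∈G y∉G G∈𝓕 = y∉G (to (x⇔y G∈𝓕) x∈G)

  record CopyThrough (G : Subset n) : Set where
    field
      i : Fin k → Subset n
      p : Fin k
      i-p : i p ≡ G
      i-p∉𝓕 : i p ∉ˡ 𝓕
      i-∈ : ∀ {r} → r ≢ p → i r ∈ˡ 𝓕
      emb : OrderEmbedding i

    injective : Injective _≡_ _≡_ i
    injective = order-embedding-injective emb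

    ⊆G⇒≼p : ∀ {a} → i a ⊆ G → a ≼ p
    ⊆G⇒≼p {a} i-a⊆G = from (emb a p) (subst (i a ⊆_) (sym i-p) i-a⊆G)

    ≼p⇒⊆G : ∀ {a} → a ≼ p → i a ⊆ G
    ≼p⇒⊆G {a} a≼p = subst (i a ⊆_) i-p (to (emb a p) a≼p)

  copy-through : ∀ {G} → G ∉ˡ 𝓕 → CopyThrough G
  copy-through {G} G∉𝓕 with proj₂ saturating G G∉𝓕
  ... | copy@(i , i∈G∷𝓕 , _) with any? (λ p → i p ≟ˢ G)
  ... | yes (p , refl) = record
    { i = i ; p = p ; i-p = refl ; i-p∉𝓕 = G∉𝓕 ; i-∈ = i-∈ ; emb = induced-copy-embedding copy }
    where
    i-∈ : ∀ {r} → r ≢ p → i r ∈ˡ 𝓕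
    i-∈ {r} r≢p with i∈G∷𝓕 r
    ... | here i-r≡i-p =
      contradiction (order-embedding-injective (induced-copy-embedding copy) i-r≡i-p) r≢p
    ... | there i-r∈𝓕 = i-r∈𝓕
  ... | no G∉i = ⊥-elim (no-copy i∈𝓕 (induced-copy-embedding copy))
    where
    i∈𝓕 : ∀ r → i r ∈ˡ 𝓕
    i∈𝓕 r with i∈G∷𝓕 r
    ... | here i-r≡G = contradiction (r , i-r≡G) G∉i
    ... | there i-r∈𝓕 = i-r∈𝓕

  Interchangeable : Subset n → Subset n → Set
  Interchangeable G K = ∀ {Z} → Z ∈ˡ 𝓕 → Z ≢ K → SameRelations G K Z

  module _ {G : Subset n} (copy : CopyThrough G) where

    open CopyThrough copy

    record Twin (K : Subset n) : Set where
      field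
        q : Fin k
        i-q : i q ≡ K
        q≢p : q ≢ p
        twins : Twins p q

      p≼q : G ⊆ K → p ≼ q
      p≼q G⊆K = from (emb p q) (subst (i p ⊆_) (sym i-q) (subst (_⊆ K) (sym i-p) G⊆K))

      q≼p : K ⊆ G → q ≼ p
      q≼p K⊆G = ⊆G⇒≼p (subst (_⊆ G) (sym i-q) K⊆G)

    agrees : ∀ {K} → Interchangeable G K → ∀ {r} → r ≢ p → i r ≢ K → SameRelations (i p) K (i r)
    agrees {K} interchangeable {r} r≢p i-r≢K =
      subst (λ X → SameRelations X K (i r)) (sym i-p) (interchangeable (i-∈ r≢p) i-r≢K)

    -- Replacing G by K preserves the copy unless K is already used, at some q, which is then a twin of p.
    replace-or-twin : ∀ {K} → K ∈ˡ 𝓕 → Interchangeable G K → Twin K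
    replace-or-twin {K} K∈𝓕 interchangeable with any? (λ q → i q ≟ˢ K)
    ... | yes (q , refl) = record
      { q = q ; i-q = refl ; q≢p = λ { refl → i-p∉𝓕 K∈𝓕 }
      ; twins = same-relations⇒twins emb λ r r≢p r≢q → agrees interchangeable r≢p (r≢q ∘ injective) }
    ... | no K∉i = ⊥-elim (no-copy (λ r → replaced-elim (_∈ˡ 𝓕) K∈𝓕 i-∈) λ a b →
        replaced-faithful a b (λ a≢p → agrees interchangeable a≢p (K∉i ∘ (a ,_)))
                              (λ b≢p → agrees interchangeable b≢p (K∉i ∘ (b ,_))))
      where open Replacement emb p K

  Minimal∋x : Subset n → Set
  Minimal∋x K = ∀ {Z} → Z ∈ˡ 𝓕 → x ∈ Z → Z ⊆ K → Z ≡ K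

  minus-interchangeable : ∀ {K} → x ∈ K → Minimal∋x K → Interchangeable (K - y) K
  minus-interchangeable {K} x∈K minimal {Z} Z∈𝓕 Z≢K = mk⇔ ⊆K-y⇒⊆K ⊆K⇒⊆K-y , mk⇔ K-y⊆⇒K⊆ K⊆⇒K-y⊆
    where
    ⊆K-y⇒⊆K : Z ⊆ K - y → Z ⊆ K
    ⊆K-y⇒⊆K Z⊆K-y z∈Z = p─q⊆p K ⁅ y ⁆ (Z⊆K-y z∈Z)
    ⊆K⇒⊆K-y : Z ⊆ K → Z ⊆ K - y
    ⊆K⇒⊆K-y Z⊆K z∈Z = x∈p∧x≢y⇒x∈p-y (Z⊆K z∈Z) λ where
      refl → Z≢K (minimal Z∈𝓕 (from (x⇔y Z∈𝓕) z∈Z) Z⊆K)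
    K-y⊆⇒K⊆ : K - y ⊆ Z → K ⊆ Z
    K-y⊆⇒K⊆ K-y⊆Z {z} z∈K with z ≟ y
    ... | yes refl = to (x⇔y Z∈𝓕) (K-y⊆Z (x∈p∧x≢y⇒x∈p-y x∈K x≢y))
    ... | no z≢y   = K-y⊆Z (x∈p∧x≢y⇒x∈p-y z∈K z≢y)
    K⊆⇒K-y⊆ : K ⊆ Z → K - y ⊆ Z
    K⊆⇒K-y⊆ K⊆Z z∈K-y = K⊆Z (p─q⊆p K ⁅ y ⁆ z∈K-y)

  plus-interchangeable : ∀ {H} → (∀ {Z} → Z ∈ˡ 𝓕 → x ∉ Z) → (∀ {Z} → Z ∈ˡ 𝓕 → H ⊆ Z → H ≡ Z) →
    Interchangeable (H ∪ ⁅ x ⁆) H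
  plus-interchangeable {H} x∉𝓕 maximal {Z} Z∈𝓕 Z≢H = mk⇔ ⊆H+x⇒⊆H ⊆H⇒⊆H+x , mk⇔ H+x⊆⇒H⊆ H⊆⇒H+x⊆
    where
    ⊆H+x⇒⊆H : Z ⊆ H ∪ ⁅ x ⁆ → Z ⊆ H
    ⊆H+x⇒⊆H Z⊆H+x {z} z∈Z with x∈p∪q⁻ H ⁅ x ⁆ (Z⊆H+x z∈Z)
    ... | inj₁ z∈H   = z∈H
    ... | inj₂ z∈⁅x⁆ = contradiction (subst (_∈ Z) (x∈⁅y⁆⇒x≡y x z∈⁅x⁆) z∈Z) (x∉𝓕 Z∈𝓕)
    ⊆H⇒⊆H+x : Z ⊆ H → Z ⊆ H ∪ ⁅ x ⁆
    ⊆H⇒⊆H+x Z⊆H z∈Z = x∈p∪q⁺ (inj₁ (Z⊆H z∈Z))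
    H+x⊆⇒H⊆ : H ∪ ⁅ x ⁆ ⊆ Z → H ⊆ Z
    H+x⊆⇒H⊆ H+x⊆Z z∈H = H+x⊆Z (x∈p∪q⁺ (inj₁ z∈H))
    H⊆⇒H+x⊆ : H ⊆ Z → H ∪ ⁅ x ⁆ ⊆ Z
    H⊆⇒H+x⊆ H⊆Z = contradiction (sym (maximal Z∈𝓕 H⊆Z)) Z≢H

  y∉⁅x⁆ : y ∉ ⁅ x ⁆
  y∉⁅x⁆ y∈⁅x⁆ = x≢y (sym (x∈⁅y⁆⇒x≡y x y∈⁅x⁆))

  -- On C the copy through ⁅ x ⁆ consists of members of 𝓕 containing x; it completes copies built on P₀.
  module E = CopyThrough (copy-through (separating∉𝓕 (x∈⁅x⁆ x) y∉⁅x⁆))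

  ∃-∈𝓕 : ∃[ Z ] Z ∈ˡ 𝓕
  ∃-∈𝓕 = let r , _ , r≢E-p = P₀-has-another E.p in E.i r , E.i-∈ r≢E-p

  ∈𝓕∧⊆⁅x⁆⇒≡∅ : ∀ {Z} → Z ∈ˡ 𝓕 → Z ⊆ ⁅ x ⁆ → Z ≡ ∅
  ∈𝓕∧⊆⁅x⁆⇒≡∅ {Z} Z∈𝓕 Z⊆⁅x⁆ = Empty-unique λ (z , z∈Z) →
    y∉⁅x⁆ (Z⊆⁅x⁆ (to (x⇔y Z∈𝓕) (subst (_∈ Z) (x∈⁅y⁆⇒x≡y x (Z⊆⁅x⁆ z∈Z)) z∈Z)))

  below-E-p-unique : ∀ {r s} → r ≢ E.p → r ≼ E.p → s ≢ E.p → s ≼ E.p → r ≡ s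
  below-E-p-unique r≢E-p r≼E-p s≢E-p s≼E-p =
    E.injective (trans (empty r≢E-p r≼E-p) (sym (empty s≢E-p s≼E-p)))
    where
    empty : ∀ {r} → r ≢ E.p → r ≼ E.p → E.i r ≡ ∅
    empty r≢E-p r≼E-p = ∈𝓕∧⊆⁅x⁆⇒≡∅ (E.i-∈ r≢E-p) (E.≼p⇒⊆G r≼E-p)

  E-p∈P₀ : P₀ E.p
  E-p∈P₀ = decidable-stable (P₀? E.p) λ E-p∉P₀ →
    let a , b , a≢b , P₀a , P₀b = two
        a≼E-p , a≢E-p = P₀≺C a E.p P₀a E-p∉P₀
        b≼E-p , b≢E-p = P₀≺C b E.p P₀b E-p∉P₀
    in a≢b (below-E-p-unique a≢E-p a≼E-p b≢E-p b≼E-p)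

  E-p-not-top-of-P₀ : ¬ (∀ {r} → P₀ r → r ≼ E.p)
  E-p-not-top-of-P₀ ≼E-p with P₀-has-another E.p
  ... | r , P₀r , r≢E-p = UCTP⇒¬two-element-chain uctp P₀r E-p∈P₀ (≼E-p P₀r , r≢E-p) only-r-and-E-p
    where
    only-r-and-E-p : ∀ z → P₀ z → z ≡ r ⊎ z ≡ E.p
    only-r-and-E-p z P₀z with z ≟ E.p
    ... | yes z≡E-p = inj₂ z≡E-p
    ... | no z≢E-p  = inj₁ (below-E-p-unique z≢E-p (≼E-p P₀z) r≢E-p (≼E-p P₀r))

  x∈E-above : ∀ {r} → E.p ≼ r → x ∈ E.i r
  x∈E-above {r} E-p≼r = to (E.emb E.p r) E-p≼r (subst (x ∈_) (sym E.i-p) (x∈⁅x⁆ x))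

  E-C-contains-x : ∀ {c} → ¬ P₀ c → E.i c ∈ˡ 𝓕 × x ∈ E.i c
  E-C-contains-x {c} c∉P₀ =
    E.i-∈ (λ { refl → c∉P₀ E-p∈P₀ }) , x∈E-above (proj₁ (P₀≺C E.p c E-p∈P₀ c∉P₀))

  ∃-minimal-with-x : ∀ {Z₀} → Z₀ ∈ˡ 𝓕 → x ∈ Z₀ →
    ∃[ K ] (K ∈ˡ 𝓕 × x ∈ K × K ⊆ Z₀ × Minimal∋x K)
  ∃-minimal-with-x {Z₀} Z₀∈𝓕 x∈Z₀ with ∃-⊆-minimal (λ Z → x ∈? Z ×-dec Z ⊆? Z₀) Z₀∈𝓕 (x∈Z₀ , ⊆-refl)
  ... | K , K∈𝓕 , (x∈K , K⊆Z₀) , minimal =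
    K , K∈𝓕 , x∈K , K⊆Z₀ , λ Z∈𝓕 x∈Z Z⊆K → minimal Z∈𝓕 (x∈Z , ⊆-trans Z⊆K K⊆Z₀) Z⊆K

  module Shrink {K} (K∈𝓕 : K ∈ˡ 𝓕) (x∈K : x ∈ K) (minimal : Minimal∋x K) where

    K-y⊆K : K - y ⊆ K
    K-y⊆K = p─q⊆p K ⁅ y ⁆

    y∉K-y : y ∉ K - y
    y∉K-y y∈K-y = x∈p─q⇒x∉q K ⁅ y ⁆ y∈K-y (x∈⁅x⁆ y)

    copy : CopyThrough (K - y)
    copy = copy-through (separating∉𝓕 (x∈p∧x≢y⇒x∈p-y x∈K x≢y) y∉K-y)

    open CopyThrough copy public

    interchangeable : Interchangeable (K - y) K
    interchangeable = minus-interchangeable x∈K minimal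

    open Twin (replace-or-twin copy K∈𝓕 interchangeable) public

    p≺q : _≺_ _≼_ p q
    p≺q = p≼q K-y⊆K , q≢p ∘ sym

    y∉below-p : ∀ {a} → a ≼ p → y ∉ i a
    y∉below-p a≼p y∈i-a = y∉K-y (≼p⇒⊆G a≼p y∈i-a)

  without-chain : (∀ r → P₀ r) → ⊥
  without-chain all-P₀ with Any.any? (x ∈?_) 𝓕
  ... | yes some-Z∋x with find some-Z∋x
  ... | _ , Z∈𝓕 , x∈Z with ∃-minimal-with-x Z∈𝓕 x∈Z
  ... | _ , K∈𝓕 , x∈K , _ , minimal = UCTP⇒¬comparable-twins uctp (all-P₀ p) (all-P₀ q) p≺q twins
    where open Shrink K∈𝓕 x∈K minimal
  without-chain all-P₀ | no no-Z∋x with ∃-⊆-maximal (proj₂ ∃-∈𝓕)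
  ... | H , H∈𝓕 , maximal =
    UCTP⇒¬comparable-twins uctp (all-P₀ q) (all-P₀ p) (q≼p H⊆H+x , q≢p) (twins-sym twins)
    where
    x∉𝓕 : ∀ {Z} → Z ∈ˡ 𝓕 → x ∉ Z
    x∉𝓕 Z∈𝓕 x∈Z = no-Z∋x (lose Z∈𝓕 x∈Z)
    H⊆H+x : H ⊆ H ∪ ⁅ x ⁆
    H⊆H+x z∈H = x∈p∪q⁺ (inj₁ z∈H)
    copy : CopyThrough (H ∪ ⁅ x ⁆)
    copy = copy-through λ H+x∈𝓕 → x∉𝓕 H+x∈𝓕 (x∈p∪q⁺ (inj₂ (x∈⁅x⁆ x)))
    open CopyThrough copy
    open Twin (replace-or-twin copy H∈𝓕 (plus-interchangeable x∉𝓕 maximal))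

  -- The least element of C is one with the smallest image under E.
  C-has-least : ∀ {c₀} → ¬ P₀ c₀ → ∃[ m ] (¬ P₀ m × (∀ {c} → ¬ P₀ c → m ≼ c))
  C-has-least c₀∉P₀ with ∃-argmin (λ c → ∣ E.i c ∣) (λ c → ¬? (P₀? c)) (∈-allFin _) c₀∉P₀
  ... | m , _ , m∉P₀ , least = m , m∉P₀ , m≼
    where
    m≼ : ∀ {c} → ¬ P₀ c → m ≼ c
    m≼ {c} c∉P₀ with chain m c m∉P₀ c∉P₀
    ... | inj₁ m≼c = m≼c
    ... | inj₂ c≼m =
      reflexive (E.injective (sym (p⊆q∧∣q∣≤∣p∣⇒p≡q (to (E.emb c m) c≼m) (least (∈-allFin c) c∉P₀))))

  module WithChain {m} (m∉P₀ : ¬ P₀ m) (m≼C : ∀ {c} → ¬ P₀ c → m ≼ c) where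

    Zₘ : Subset n
    Zₘ = E.i m

    Zₘ∈𝓕 : Zₘ ∈ˡ 𝓕
    Zₘ∈𝓕 = proj₁ (E-C-contains-x m∉P₀)

    x∈Zₘ : x ∈ Zₘ
    x∈Zₘ = proj₂ (E-C-contains-x m∉P₀)

    y∈Zₘ : y ∈ Zₘ
    y∈Zₘ = to (x⇔y Zₘ∈𝓕) x∈Zₘ

    Zₘ⊆C : ∀ {c} → ¬ P₀ c → Zₘ ⊆ E.i c
    Zₘ⊆C c∉P₀ = to (E.emb m _) (m≼C c∉P₀)

    -- f on P₀ glued with E.i on C is a copy of P inside 𝓕.
    strictly-below-Zₘ⇒⊥ : ∀ {f} → (∀ {a} → P₀ a → f a ∈ˡ 𝓕) → (∀ a b → P₀ a → P₀ b → Faithful f a b) →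
      (∀ {a} → P₀ a → f a ⊆ Zₘ) → (∀ {a} → P₀ a → Zₘ ⊈ f a) → ⊥
    strictly-below-Zₘ⇒⊥ {f} f∈𝓕 f-faithful ⊆Zₘ Zₘ⊈ =
      no-copy {glue inP₀ f E.i}
        (λ r → glue-elim inP₀ (_∈ˡ 𝓕) {f} {E.i} {r} f∈𝓕 (proj₁ ∘ E-C-contains-x))
        (glue-embedding inP₀ {f} {E.i} P₀≺C f-faithful (λ c d _ _ → E.emb c d)
          (λ a c P₀a c∉P₀ → ⊆-trans (⊆Zₘ P₀a) (Zₘ⊆C c∉P₀))
          (λ a c P₀a c∉P₀ E-c⊆f-a → Zₘ⊈ P₀a (⊆-trans (Zₘ⊆C c∉P₀) E-c⊆f-a)))

    module BelowZₘ {K} (K∈𝓕 : K ∈ˡ 𝓕) (x∈K : x ∈ K) (K⊆Zₘ : K ⊆ Zₘ) (minimal : Minimal∋x K) where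

      open Shrink K∈𝓕 x∈K minimal

      below-p⊆Zₘ : ∀ {a} → a ≼ p → i a ⊆ Zₘ
      below-p⊆Zₘ a≼p = ⊆-trans (≼p⇒⊆G a≼p) (⊆-trans K-y⊆K K⊆Zₘ)

      p∉P₀⇒⊥ : ¬ P₀ p → ⊥
      p∉P₀⇒⊥ p∉P₀ =
        strictly-below-Zₘ⇒⊥ (λ P₀a → i-∈ λ { refl → p∉P₀ P₀a }) (λ a b _ _ → emb a b)
          (λ P₀a → below-p⊆Zₘ (below-p P₀a)) (λ P₀a Zₘ⊆i-a → y∉below-p (below-p P₀a) (Zₘ⊆i-a y∈Zₘ))
        where
        below-p : ∀ {a} → P₀ a → a ≼ p
        below-p P₀a = proj₁ (P₀≺C _ p P₀a p∉P₀)

      top-of-P₀ : ¬ P₀ q → ∀ {r} → P₀ r → r ≼ p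
      top-of-P₀ q∉P₀ {r} P₀r with r ≟ p
      ... | yes refl = ≼-refl
      ... | no r≢p   = from (proj₁ (twins r r≢p λ { refl → q∉P₀ P₀r })) (proj₁ (P₀≺C r q P₀r q∉P₀))

      p-top⇒⊥ : P₀ p → ¬ P₀ q → ⊥
      p-top⇒⊥ P₀p q∉P₀ with p ≟ E.p
      ... | yes p≡E-p = E-p-not-top-of-P₀ (subst (_ ≼_) p≡E-p ∘ top-of-P₀ q∉P₀)
      ... | no p≢E-p =
        strictly-below-Zₘ⇒⊥ (λ _ → replaced-elim (_∈ˡ 𝓕) K∈𝓕 i-∈)
          (λ a b P₀a P₀b → replaced-faithful a b (agrees-P₀ P₀a) (agrees-P₀ P₀b))
          (λ P₀a → replaced-elim (_⊆ Zₘ) K⊆Zₘ λ _ → below-p⊆Zₘ (top-of-P₀ q∉P₀ P₀a))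
          (λ P₀a → replaced-elim (Zₘ ⊈_) Zₘ⊈K λ _ Zₘ⊆i-a → y∉below-p (top-of-P₀ q∉P₀ P₀a) (Zₘ⊆i-a y∈Zₘ))
        where
        open Replacement emb p K
        agrees-P₀ : ∀ {a} → P₀ a → a ≢ p → SameRelations (i p) K (i a)
        agrees-P₀ P₀a a≢p = agrees copy interchangeable a≢p λ i-a≡K →
          q∉P₀ (subst P₀ (injective (trans i-a≡K (sym i-q))) P₀a)
        Zₘ⊈K : Zₘ ⊈ K
        Zₘ⊈K Zₘ⊆K = m∉P₀ (subst P₀ (E.injective E-p≡Zₘ) P₀p)
          where
          E-p⊆Zₘ : E.i p ⊆ Zₘ
          E-p⊆Zₘ = to (E.emb p m) (proj₁ (P₀≺C p m P₀p m∉P₀))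
          E-p≡Zₘ : E.i p ≡ Zₘ
          E-p≡Zₘ = trans (minimal (E.i-∈ p≢E-p) (x∈E-above (top-of-P₀ q∉P₀ E-p∈P₀)) (⊆-trans E-p⊆Zₘ Zₘ⊆K))
                         (⊆-antisym K⊆Zₘ Zₘ⊆K)

      absurd : ⊥
      absurd with P₀? p | P₀? q
      ... | no p∉P₀ | _        = p∉P₀⇒⊥ p∉P₀
      ... | yes P₀p | yes P₀q  = UCTP⇒¬comparable-twins uctp P₀p P₀q p≺q twins
      ... | yes P₀p | no q∉P₀  = p-top⇒⊥ P₀p q∉P₀

    absurd : ⊥
    absurd with ∃-minimal-with-x Zₘ∈𝓕 x∈Zₘ
    ... | _ , K∈𝓕 , x∈K , K⊆Zₘ , minimal = BelowZₘ.absurd K∈𝓕 x∈K K⊆Zₘ minimal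

  absurd : ⊥
  absurd with any? (λ c → ¬? (P₀? c))
  ... | yes (_ , c₀∉P₀) = let _ , m∉P₀ , m≼C = C-has-least c₀∉P₀ in WithChain.absurd m∉P₀ m≼C
  ... | no no-C         = without-chain λ r → decidable-stable (P₀? r) λ r∉P₀ → no-C (r , r∉P₀)

separated-or-indistinguishable : ∀ {n} (𝓕 : List (Subset n)) x y →
  (∃[ F ] (F ∈ˡ 𝓕 × ((x ∈ F × y ∉ F) ⊎ (x ∉ F × y ∈ F)))) ⊎ (∀ {Z} → Z ∈ˡ 𝓕 → x ∈ Z ⇔ y ∈ Z)
separated-or-indistinguishable 𝓕 x y
  with Any.any? (λ F → (x ∈? F ×-dec ¬? (y ∈? F)) ⊎-dec (¬? (x ∈? F) ×-dec y ∈? F)) 𝓕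
... | yes separated = inj₁ (find separated)
... | no unseparated = inj₂ λ {Z} Z∈𝓕 →
  mk⇔ (λ x∈Z → decidable-stable (y ∈? Z) λ y∉Z → unseparated (lose Z∈𝓕 (inj₁ (x∈Z , y∉Z))))
      (λ y∈Z → decidable-stable (x ∈? Z) λ x∉Z → unseparated (lose Z∈𝓕 (inj₂ (x∉Z , y∈Z))))

theorem16 : (k : ℕ) (_≼_ : Fin k → Fin k → Set) → IsPartialOrder _≡_ _≼_ →
    UCTPWithTopChain _≼_ →
    (n : ℕ) (𝓕 : List (Subset n)) → Unique 𝓕 → InducedSaturating _≼_ 𝓕 →
    Separating 𝓕 × ⌈log₂ n ⌉ ≤ length 𝓕
theorem16 k _≼_ po (inP₀ , two , uctp , chain , P₀≺C) n 𝓕 _ saturating =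
  separating , separating⇒⌈log₂⌉≤length separating
  where
  separating : Separating 𝓕
  separating x y x≢y with separated-or-indistinguishable 𝓕 x y
  ... | inj₁ separated = separated
  ... | inj₂ indistinguishable =
    ⊥-elim (Unseparated.absurd po two uctp chain P₀≺C saturating x≢y indistinguishable)
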